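{- Let $\mathbf{M}=[\underline{M},\overline{M}]$ be an $m\times n$ interval matrix. Consider the linear program in real variables $x_{k\ell}$ ($1\le k\le m$, $1\le\ell\le n$): minimize a constant subject to $x_{ij}+x_{i+1,j+1}-x_{i,j+1}-x_{i+1,j}\le 0$ for all $1\le i<m$, $1\le j<n$; $x_{k\ell}\le\overline{m}_{k\ell}$ and $-x_{k\ell}\le-\underline{m}_{k\ell}$ for all $1\le k\le m$, $1\le\ell\le n$. Then $\mathbf{M}$ has the weak Monge property if and only if this linear program has a feasible solution.
   Context: An interval matrix $\mathbf{M}=[\underline{M},\overline{M}]$ with real $m\times n$ matrices $\underline{M}\le\overline{M}$ (entrywise) is the set $\{A\in\mathbb{R}^{m\times n}:\underline{M}\le A\le\overline{M}\}$, with entries $\mathbf{m}_{ij}=[\underline{m}_{ij},\overline{m}_{ij}]$. A real matrix $A$ is Monge if $a_{ij}+a_{k\ell}\le a_{i\ell}+a_{kj}$ for all $1\le i<k\le m$, $1\le j<\ell\le n$. $\mathbf{M}$ has the weak Monge property if there exists a Monge matrix $M\in\mathbf{M}$. -}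

module Defs where

open import Level using (Level; _⊔_) renaming (suc to lsuc)
open import Algebra.Bundles using (CommutativeRing)
open import Relation.Binary.Structures using (IsTotalOrder)
open import Relation.Nullary using (¬_)
open import Data.Product using (_×_; ∃)
open import Data.Nat using (ℕ; suc)
open import Data.Fin using (Fin; toℕ) renaming (_<_ to _<ᶠ_)
open import Relation.Binary.PropositionalEquality using (_≡_)

-- An ordered field (the real numbers are an instance).  The statement is
-- proved for every ordered field, which in particular covers ℝ.
record OrderedField (c ℓ ℓ′ : Level) : Set (lsuc (c ⊔ ℓ ⊔ ℓ′)) where
  field
    commutativeRing : CommutativeRing c ℓ
  open CommutativeRing commutativeRing public
  field
    _≤_          : Carrier → Carrier → Set ℓ′
    isTotalOrder : IsTotalOrder _≈_ _≤_
    +-monoˡ-≤    : ∀ {x y} z → x ≤ y → (x + z) ≤ (y + z)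
    *-nonneg     : ∀ {x y} → 0# ≤ x → 0# ≤ y → 0# ≤ (x * y)
    0≉1          : ¬ (0# ≈ 1#)
    inverse      : ∀ x → ¬ (x ≈ 0#) → ∃ λ y → (x * y) ≈ 1#

module _ {c ℓ ℓ′} (F : OrderedField c ℓ ℓ′) where
  open OrderedField F

  Matrix : ℕ → ℕ → Set c
  Matrix m n = Fin m → Fin n → Carrier

  _≤ᴹ_ : ∀ {m n} → Matrix m n → Matrix m n → Set ℓ′
  A ≤ᴹ B = ∀ i j → A i j ≤ B i j

  InInterval : ∀ {m n} → Matrix m n → Matrix m n → Matrix m n → Set ℓ′
  InInterval Lo Up A = (Lo ≤ᴹ A) × (A ≤ᴹ Up)

  IsMonge : ∀ {m n} → Matrix m n → Set ℓ′
  IsMonge {m} {n} A = ∀ (i k : Fin m) (j l : Fin n) → i <ᶠ k → j <ᶠ l →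
    (A i j + A k l) ≤ (A i l + A k j)

  WeakMonge : ∀ {m n} → Matrix m n → Matrix m n → Set (c ⊔ ℓ′)
  WeakMonge Lo Up = ∃ λ M → InInterval Lo Up M × IsMonge M

  -- feasibility of the linear program of Theorem 4.1 (the objective is a
  -- constant, so the LP is solvable iff its constraint system is feasible).
  -- i′ , j′ play the role of i+1 , j+1.
  LPFeasibleSolution : ∀ {m n} → Matrix m n → Matrix m n → Matrix m n → Set ℓ′
  LPFeasibleSolution {m} {n} Lo Up x =
    (∀ (i i′ : Fin m) (j j′ : Fin n) → toℕ i′ ≡ suc (toℕ i) → toℕ j′ ≡ suc (toℕ j) →
       (((x i j + x i′ j′) - x i j′) - x i′ j) ≤ 0#)
    × (∀ k l → x k l ≤ Up k l)
    × (∀ k l → (- x k l) ≤ (- Lo k l))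

  LPFeasible : ∀ {m n} → Matrix m n → Matrix m n → Set (c ⊔ ℓ′)
  LPFeasible Lo Up = ∃ λ x → LPFeasibleSolution Lo Up x

-- The Monge inequality only has to be checked on 2 × 2 blocks of adjacent rows and
-- columns: two Monge inequalities for blocks sharing a row (or a column) add up,
-- after cancelling the two entries on the shared line, to the Monge inequality of
-- the union of the blocks, so the general case follows by telescoping first over
-- columns and then over rows. The first family of LP constraints is exactly this
-- adjacent condition, and the bound constraints say that the solution lies in
-- [Lo , Up].

module Submission where

open import Defs
open import Level using (Level)
open import Data.Nat using (ℕ)
open import Data.Product using (_×_; _,_)

open import Data.Nat.Base using (zero; suc; s≤s; _<_; _≤′_; ≤′-refl; ≤′-step)
  renaming (_≤_ to _≤ℕ_)
open import Data.Nat.Properties using (≤⇒≤′; ≤-trans; n≤1+n; ≤-reflexive)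
open import Data.Fin.Base using (Fin; toℕ)
open import Data.Fin.Properties using (toℕ≤pred[n])
open import Relation.Binary.Bundles using (Poset)
open import Relation.Binary.Structures using (IsTotalOrder)
open import Relation.Binary.PropositionalEquality as ≡ using (_≡_; refl; cong)
import Relation.Binary.Reasoning.PartialOrder as PosetReasoning

clamp : (n : ℕ) → ℕ → Fin (suc n)
clamp zero    _       = Fin.zero
clamp (suc n) zero    = Fin.zero
clamp (suc n) (suc a) = Fin.suc (clamp n a)

toℕ-clamp : ∀ {n a} → a ≤ℕ n → toℕ (clamp n a) ≡ a
toℕ-clamp {zero}  {zero}  _         = refl
toℕ-clamp {suc n} {zero}  _         = refl
toℕ-clamp {suc n} {suc a} (s≤s a≤n) = cong suc (toℕ-clamp a≤n)

toℕ-clamp-suc : ∀ {n a} → suc a ≤ℕ n → toℕ (clamp n (suc a)) ≡ suc (toℕ (clamp n a))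
toℕ-clamp-suc {a = a} 1+a≤n =
  ≡.trans (toℕ-clamp 1+a≤n) (cong suc (≡.sym (toℕ-clamp (≤-trans (n≤1+n a) 1+a≤n))))

clamp-toℕ : ∀ {n} (i : Fin (suc n)) → clamp n (toℕ i) ≡ i
clamp-toℕ {zero}  Fin.zero    = refl
clamp-toℕ {suc n} Fin.zero    = refl
clamp-toℕ {suc n} (Fin.suc i) = cong Fin.suc (clamp-toℕ i)

stepwise⇒< : ∀ {p} (P : ℕ → ℕ → Set p) {n} →
  (∀ {a b c} → P a b → P b c → P a c) →
  (∀ a → suc a ≤ℕ n → P a (suc a)) →
  ∀ {a c} → a < c → c ≤ℕ n → P a c
stepwise⇒< P {n} trans step {a} a<c = go (≤⇒≤′ a<c)
  where
  go : ∀ {c} → suc a ≤′ c → c ≤ℕ n → P a c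
  go ≤′-refl           c≤n = step a c≤n
  go (≤′-step {c} a<c) c≤n = trans (go a<c (≤-trans (n≤1+n c) c≤n)) (step c c≤n)

module OrderedFieldProperties {c ℓ ℓ′} (F : OrderedField c ℓ ℓ′) where
  open OrderedField F renaming (refl to ≈-refl)
  open import Algebra.Properties.AbelianGroup +-abelianGroup using (⁻¹-∙-comm; xyx⁻¹≈y)
  open import Algebra.Properties.Group +-group using (//-rightDividesˡ; //-rightDividesʳ; ⁻¹-involutive)
  open import Algebra.Solver.CommutativeMonoid +-commutativeMonoid using (solve; _⊜_; _⊕_)

  poset : Poset c ℓ ℓ′
  poset = record { isPartialOrder = IsTotalOrder.isPartialOrder isTotalOrder }

  open PosetReasoning poset

  +-monoʳ-≤ : ∀ {x y} z → x ≤ y → (z + x) ≤ (z + y)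
  +-monoʳ-≤ {x} {y} z x≤y = begin
    z + x  ≈⟨ +-comm z x ⟩
    x + z  ≤⟨ +-monoˡ-≤ z x≤y ⟩
    y + z  ≈⟨ +-comm y z ⟩
    z + y  ∎

  +-mono-≤ : ∀ {x y u v} → x ≤ y → u ≤ v → (x + u) ≤ (y + v)
  +-mono-≤ {x} {y} {u} {v} x≤y u≤v = begin
    x + u  ≤⟨ +-monoˡ-≤ u x≤y ⟩
    y + u  ≤⟨ +-monoʳ-≤ y u≤v ⟩
    y + v  ∎

  x≤y⇒x-y≤0 : ∀ {x y} → x ≤ y → (x - y) ≤ 0#
  x≤y⇒x-y≤0 {x} {y} x≤y = begin
    x - y  ≤⟨ +-monoˡ-≤ (- y) x≤y ⟩
    y - y  ≈⟨ -‿inverseʳ y ⟩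
    0#     ∎

  x-y≤0⇒x≤y : ∀ {x y} → (x - y) ≤ 0# → x ≤ y
  x-y≤0⇒x≤y {x} {y} x-y≤0 = begin
    x            ≈⟨ //-rightDividesˡ y x ⟨
    (x - y) + y  ≤⟨ +-monoˡ-≤ y x-y≤0 ⟩
    0# + y       ≈⟨ +-identityˡ y ⟩
    y            ∎

  +-cancelʳ-≤ : ∀ {x y} z → (x + z) ≤ (y + z) → x ≤ y
  +-cancelʳ-≤ {x} {y} z x+z≤y+z = begin
    x            ≈⟨ //-rightDividesʳ z x ⟨
    (x + z) - z  ≤⟨ +-monoˡ-≤ (- z) x+z≤y+z ⟩
    (y + z) - z  ≈⟨ //-rightDividesʳ z y ⟩
    y            ∎

  neg-mono-≤ : ∀ {x y} → x ≤ y → (- y) ≤ (- x)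
  neg-mono-≤ {x} {y} x≤y = begin
    - y            ≈⟨ xyx⁻¹≈y x (- y) ⟨
    (x - y) - x    ≤⟨ +-monoˡ-≤ (- x) (x≤y⇒x-y≤0 x≤y) ⟩
    0# - x         ≈⟨ +-identityˡ (- x) ⟩
    - x            ∎

  neg-cancel-≤ : ∀ {x y} → (- x) ≤ (- y) → y ≤ x
  neg-cancel-≤ {x} {y} -x≤-y = begin
    y      ≈⟨ ⁻¹-involutive y ⟨
    - - y  ≤⟨ neg-mono-≤ -x≤-y ⟩
    - - x  ≈⟨ ⁻¹-involutive x ⟩
    x      ∎

  x-y-z≈x-[y+z] : ∀ x y z → ((x - y) - z) ≈ (x - (y + z))
  x-y-z≈x-[y+z] x y z = trans (+-assoc x (- y) (- z)) (+-congˡ (⁻¹-∙-comm y z))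

  x≤y+z⇒x-y-z≤0 : ∀ {x y z} → x ≤ (y + z) → ((x - y) - z) ≤ 0#
  x≤y+z⇒x-y-z≤0 {x} {y} {z} x≤y+z = begin
    (x - y) - z  ≈⟨ x-y-z≈x-[y+z] x y z ⟩
    x - (y + z)  ≤⟨ x≤y⇒x-y≤0 x≤y+z ⟩
    0#           ∎

  x-y-z≤0⇒x≤y+z : ∀ {x y z} → ((x - y) - z) ≤ 0# → x ≤ (y + z)
  x-y-z≤0⇒x≤y+z {x} {y} {z} x-y-z≤0 = x-y≤0⇒x≤y (begin
    x - (y + z)  ≈⟨ x-y-z≈x-[y+z] x y z ⟨
    (x - y) - z  ≤⟨ x-y-z≤0 ⟩
    0#           ∎)

  x+y≤u+v⇒v+z≤y+w⇒x+z≤u+w : ∀ {x y u v z w} →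
    (x + y) ≤ (u + v) → (v + z) ≤ (y + w) → (x + z) ≤ (u + w)
  x+y≤u+v⇒v+z≤y+w⇒x+z≤u+w {x} {y} {u} {v} {z} {w} p q = +-cancelʳ-≤ (y + v) (begin
    (x + z) + (y + v)  ≈⟨ solve 4 (λ x y v z → (x ⊕ z) ⊕ (y ⊕ v) ⊜ (x ⊕ y) ⊕ (v ⊕ z)) ≈-refl x y v z ⟩
    (x + y) + (v + z)  ≤⟨ +-mono-≤ p q ⟩
    (u + v) + (y + w)  ≈⟨ solve 4 (λ y u v w → (u ⊕ v) ⊕ (y ⊕ w) ⊜ (u ⊕ w) ⊕ (y ⊕ v)) ≈-refl y u v w ⟩
    (u + w) + (y + v)  ∎)

module MongeProperties {c ℓ ℓ′} (F : OrderedField c ℓ ℓ′) where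
  open OrderedField F
  open OrderedFieldProperties F
  open IsTotalOrder isTotalOrder using (≤-respʳ-≈)

  MongeAt : ∀ {a b} {I : Set a} {J : Set b} → (I → J → Carrier) → I → J → I → J → Set ℓ′
  MongeAt A i j k l = (A i j + A k l) ≤ (A i l + A k j)

  module _ {a b} {I : Set a} {J : Set b} (A : I → J → Carrier) where

    mongeAt-trans-rows : ∀ {i r k j l} → MongeAt A i j r l → MongeAt A r j k l → MongeAt A i j k l
    mongeAt-trans-rows = x+y≤u+v⇒v+z≤y+w⇒x+z≤u+w

    mongeAt-trans-cols : ∀ {i k j s l} → MongeAt A i j k s → MongeAt A i s k l → MongeAt A i j k l
    mongeAt-trans-cols p q = swapʳ (x+y≤u+v⇒v+z≤y+w⇒x+z≤u+w (swapʳ p) (swapʳ q))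
      where
      swapʳ : ∀ {x y z} → x ≤ (y + z) → x ≤ (z + y)
      swapʳ = ≤-respʳ-≈ (+-comm _ _)

  adjacentMonge⇒monge : (g : ℕ → ℕ → Carrier) {m n : ℕ} →
    (∀ i j → suc i ≤ℕ m → suc j ≤ℕ n → MongeAt g i j (suc i) (suc j)) →
    ∀ {i j k l} → i < k → k ≤ℕ m → j < l → l ≤ℕ n → MongeAt g i j k l
  adjacentMonge⇒monge g adjacent {j = j} {l = l} i<k k≤m j<l l≤n =
    stepwise⇒< (λ i k → MongeAt g i j k l) (mongeAt-trans-rows g) adjacentRows i<k k≤m
    where
    adjacentRows : ∀ i → suc i ≤ℕ _ → MongeAt g i j (suc i) l
    adjacentRows i 1+i≤m = stepwise⇒< (λ j l → MongeAt g i j (suc i) l) (mongeAt-trans-cols g)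
      (λ j 1+j≤n → adjacent i j 1+i≤m 1+j≤n) j<l l≤n

  weakMonge⇒lpFeasible : ∀ {m n} {Lo Up : Matrix F m n} → WeakMonge F Lo Up → LPFeasible F Lo Up
  weakMonge⇒lpFeasible (M , (Lo≤M , M≤Up) , monge) =
    M , adjacentConstraints , M≤Up , λ k l → neg-mono-≤ (Lo≤M k l)
    where
    adjacentConstraints : ∀ i i′ j j′ → toℕ i′ ≡ suc (toℕ i) → toℕ j′ ≡ suc (toℕ j) →
      (((M i j + M i′ j′) - M i j′) - M i′ j) ≤ 0#
    adjacentConstraints i i′ j j′ i′≡1+i j′≡1+j = x≤y+z⇒x-y-z≤0
      (monge i i′ j j′ (≤-reflexive (≡.sym i′≡1+i)) (≤-reflexive (≡.sym j′≡1+j)))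

  -- Extending a matrix to ℕ × ℕ by clamping its indices lets the telescoping run over ℕ.
  clamped : ∀ {m n} → Matrix F (suc m) (suc n) → ℕ → ℕ → Carrier
  clamped {m} {n} A a b = A (clamp m a) (clamp n b)

  mongeAt-clamped : ∀ {m n} (A : Matrix F (suc m) (suc n)) i j k l →
    MongeAt (clamped A) (toℕ i) (toℕ j) (toℕ k) (toℕ l) → MongeAt A i j k l
  mongeAt-clamped A i j k l p
    rewrite clamp-toℕ i | clamp-toℕ j | clamp-toℕ k | clamp-toℕ l = p

  lpSolution⇒monge : ∀ {m n} {Lo Up x : Matrix F m n} → LPFeasibleSolution F Lo Up x → IsMonge F x
  lpSolution⇒monge {zero} _ ()
  lpSolution⇒monge {suc m} {zero} _ _ _ ()
  lpSolution⇒monge {suc m} {suc n} {x = x} (adjacent , _) i k j l i<k j<l =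
    mongeAt-clamped x i j k l
      (adjacentMonge⇒monge (clamped x) adjacentClamped i<k (toℕ≤pred[n] k) j<l (toℕ≤pred[n] l))
    where
    adjacentClamped : ∀ a b → suc a ≤ℕ m → suc b ≤ℕ n → MongeAt (clamped x) a b (suc a) (suc b)
    adjacentClamped a b 1+a≤m 1+b≤n = x-y-z≤0⇒x≤y+z
      (adjacent (clamp m a) (clamp m (suc a)) (clamp n b) (clamp n (suc b))
        (toℕ-clamp-suc 1+a≤m) (toℕ-clamp-suc 1+b≤n))

  lpFeasible⇒weakMonge : ∀ {m n} {Lo Up : Matrix F m n} → LPFeasible F Lo Up → WeakMonge F Lo Up
  lpFeasible⇒weakMonge (x , solution@(_ , x≤Up , -x≤-Lo)) =
    x , ((λ k l → neg-cancel-≤ (-x≤-Lo k l)) , x≤Up) , lpSolution⇒monge solution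

theorem4p1 : ∀ {c ℓ ℓ′ : Level} (F : OrderedField c ℓ ℓ′) (m n : ℕ)
    (Lo Up : Matrix F m n) → _≤ᴹ_ F Lo Up →
    (WeakMonge F Lo Up → LPFeasible F Lo Up) × (LPFeasible F Lo Up → WeakMonge F Lo Up)
theorem4p1 F m n Lo Up _ = weakMonge⇒lpFeasible , lpFeasible⇒weakMonge
  where open MongeProperties F
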